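{- Let $M$ be a model of $\mathcal{T}_N$ and let $A\subseteq M^n$ be a nonempty simple set. Then $A$ is in definable bijection with some Cartesian power of $M$; more precisely, if $A$ has $d$ equivalence classes, then $A$ is in definable bijection with $M^d$.
   Context: Fix a positive integer $N$. $\mathcal{T}_N$ is the theory in the language $\{f,c_1,\dots,c_N\}$ ($f$ unary, $c_i$ constants) stating: the $c_i$ are pairwise distinct; $f$ is a bijection from $M$ onto $M\setminus\{c_1,\dots,c_N\}$; and $f^n(x)\neq x$ for all $x$ and all $n\geq1$ ($f^n$ the $n$-th iterate, $f^0$ the identity). Definable means definable with parameters from $M$. A subset $A\subseteq M^n$ is simple if it is definable by a finite conjunction of formulas of the form $x_i=f^k(x_j)$ ($1\le i,j\le n$, $k\in\mathbb{N}$) and $x_i=c$ ($c\in M$, $1\le i\le n$). For a simple set $A\subseteq M^n$, let $C=\{i\in\{1,\dots,n\}: \exists a\in M\,\forall x\in A,\ x_i=a\}$; on $\{1,\dots,n\}\setminus C$ consider the equivalence relation: $i\sim j$ iff there is $k\in\mathbb{N}$ with $x_i=f^k(x_j)$ for all $x\in A$ or $x_j=f^k(x_i)$ for all $x\in A$. Its classes are the equivalence classes of $A$; $M^0$ is a singleton. -}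

module Defs where

open import Data.Nat using (ℕ; zero; suc; _+_)
open import Data.Fin using (Fin)
open import Data.Product using (Σ; _×_; _,_)
open import Data.Sum using (_⊎_)
open import Data.Empty using (⊥)
open import Data.Unit using (⊤)
open import Data.Maybe using (Maybe; just; nothing)
open import Data.List using (List)
open import Data.List.Relation.Unary.All using (All)
open import Data.Vec.Functional using (Vector; _∷_; _++_)
open import Relation.Nullary using (¬_)
open import Relation.Binary.PropositionalEquality using (_≡_; _≢_)

iter : {X : Set} → (X → X) → ℕ → X → X
iter f zero x = x
iter f (suc n) x = f (iter f n x)

record Model (N : ℕ) : Set₁ where
  field
    M       : Set
    f       : M → M
    c       : Fin N → M
    c-inj   : ∀ i j → c i ≡ c j → i ≡ j
    f-inj   : ∀ x y → f x ≡ f y → x ≡ y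
    f-avoid : ∀ x i → f x ≢ c i
    f-onto  : ∀ y → (∀ i → y ≢ c i) → Σ M (λ x → f x ≡ y)
    acyclic : ∀ (k : ℕ) x → iter f (suc k) x ≢ x

module _ {N : ℕ} (𝓜 : Model N) where
  open Model 𝓜

  -- first-order syntax of the language {f, c_1..c_N} with parameters from M;
  -- a term/formula indexed by k has free variables among Fin k
  data Term (k : ℕ) : Set where
    var : Fin k → Term k
    par : M → Term k
    con : Fin N → Term k
    app : Term k → Term k

  data Formula : ℕ → Set where
    _≐_  : ∀ {k} → Term k → Term k → Formula k
    ⊥f   : ∀ {k} → Formula k
    ¬f   : ∀ {k} → Formula k → Formula k
    _∧f_ : ∀ {k} → Formula k → Formula k → Formula k
    _∨f_ : ∀ {k} → Formula k → Formula k → Formula k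
    ∃f   : ∀ {k} → Formula (suc k) → Formula k
    ∀f   : ∀ {k} → Formula (suc k) → Formula k

  evalT : ∀ {k} → Vector M k → Term k → M
  evalT ρ (var i) = ρ i
  evalT ρ (par a) = a
  evalT ρ (con i) = c i
  evalT ρ (app t) = f (evalT ρ t)

  -- satisfaction; the bound variable of ∃f/∀f is variable zero
  Sat : ∀ {k} → Formula k → Vector M k → Set
  Sat (s ≐ t)  ρ = evalT ρ s ≡ evalT ρ t
  Sat ⊥f       ρ = ⊥
  Sat (¬f φ)   ρ = ¬ Sat φ ρ
  Sat (φ ∧f ψ) ρ = Sat φ ρ × Sat ψ ρ
  Sat (φ ∨f ψ) ρ = Sat φ ρ ⊎ Sat ψ ρ
  Sat (∃f φ)   ρ = Σ M (λ a → Sat φ (a ∷ ρ))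
  Sat (∀f φ)   ρ = (a : M) → Sat φ (a ∷ ρ)

  Subset : ℕ → Set₁
  Subset n = Vector M n → Set

  Definable : ∀ {n} → Subset n → Set
  Definable {n} A =
    Σ (Formula n) (λ φ → (∀ x → A x → Sat φ x) × (∀ x → Sat φ x → A x))

  _≈_ : ∀ {n} → Vector M n → Vector M n → Set
  x ≈ y = ∀ i → x i ≡ y i

  record DefBij {n m : ℕ} (A : Subset n) (B : Subset m) : Set₁ where
    field
      G          : Subset (n + m)
      G-def      : Definable G
      G-dom      : ∀ (x : Vector M n) (y : Vector M m) → G (x ++ y) → A x
      G-cod      : ∀ (x : Vector M n) (y : Vector M m) → G (x ++ y) → B y
      G-total    : ∀ x → A x → Σ (Vector M m) (λ y → G (x ++ y))
      G-func     : ∀ (x : Vector M n) y y′ → G (x ++ y) → G (x ++ y′) → y ≈ y′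
      G-surj     : ∀ y → B y → Σ (Vector M n) (λ x → G (x ++ y))
      G-inj      : ∀ x x′ (y : Vector M m) → G (x ++ y) → G (x′ ++ y) → x ≈ x′

  Full : ∀ d → Subset d
  Full d _ = ⊤

  data Atom (n : ℕ) : Set where
    eqf : Fin n → ℕ → Fin n → Atom n
    eqc : Fin n → M → Atom n

  HoldsAtom : ∀ {n} → Vector M n → Atom n → Set
  HoldsAtom x (eqf i k j) = x i ≡ iter f k (x j)
  HoldsAtom x (eqc i a)   = x i ≡ a

  Simple : ∀ {n} → Subset n → Set
  Simple {n} A = Σ (List (Atom n)) (λ L →
    (∀ x → A x → All (HoldsAtom x) L) × (∀ x → All (HoldsAtom x) L → A x))

  IsConst : ∀ {n} → Subset n → Fin n → Set
  IsConst A i = Σ M (λ a → ∀ x → A x → x i ≡ a)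

  Linked : ∀ {n} → Subset n → Fin n → Fin n → Set
  Linked A i j = Σ ℕ (λ k →
    (∀ x → A x → x i ≡ iter f k (x j)) ⊎ (∀ x → A x → x j ≡ iter f k (x i)))

  -- A has exactly d equivalence classes: there is a map cls sending coordinates
  -- in C to nothing and the others to their class, inducing a bijection between
  -- the set of ~-classes on {1..n}∖C and Fin d
  record HasClasses {n : ℕ} (A : Subset n) (d : ℕ) : Set where
    field
      cls       : Fin n → Maybe (Fin d)
      cls-C     : ∀ i → cls i ≡ nothing → IsConst A i
      C-cls     : ∀ i → IsConst A i → cls i ≡ nothing
      cls-sound : ∀ i j a b → cls i ≡ just a → cls j ≡ just b →
                    a ≡ b → Linked A i j
      cls-compl : ∀ i j a b → cls i ≡ just a → cls j ≡ just b →
                    Linked A i j → a ≡ b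
      cls-surj  : ∀ a → Σ (Fin n) (λ i → cls i ≡ just a)

{-# OPTIONS --safe #-}
-- Within a ~-class any two coordinates are comparable (one is a fixed iterate of the other on A),
-- so each class has a root coordinate of which all its members are fixed iterates. Projecting A onto
-- the d roots is injective, and it is onto M^d: given y, put y_a at the root of class a, the forced
-- iterates on the rest of the class, and the constants on C. Since f is injective without cycles the
-- exponents of a class are uniquely determined and coherent, so this tuple satisfies every atom of A.
-- The graph of the projection is again a simple set, hence definable.
module Submission where

open import Defs
open import Data.Nat using (ℕ; zero; suc; _+_; _≤_)
open import Data.Fin using (Fin; _↑ˡ_; _↑ʳ_) renaming (_≟_ to _≟ᶠ_)
open import Data.Product using (Σ; _,_; proj₁; proj₂; _×_)
open import Data.Sum using (_⊎_; inj₁; inj₂)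
open import Data.Unit using (tt)
open import Data.Maybe using (just; nothing)
open import Data.Maybe.Properties using (just-injective) renaming (≡-dec to ≡-decᵐ)
open import Data.List using (List; []; _∷_; map; tabulate; allFin) renaming (_++_ to _++ᴸ_)
open import Data.List.Relation.Unary.All as All using (All; []; _∷_)
open import Data.List.Relation.Unary.All.Properties using (map⁺; map⁻; ++⁺; ++⁻; tabulate⁺; tabulate⁻)
open import Data.Vec.Functional using (Vector; _++_)
open import Data.Vec.Functional.Properties using (lookup-++ˡ; lookup-++ʳ)
open import Level using (Level)
open import Function using (_∘_; id)
open import Relation.Binary.Core using (Rel)
open import Relation.Binary.Definitions using (Reflexive; Transitive)
open import Relation.Nullary using (¬_; yes; no; contradiction)
open import Relation.Unary using (Pred; Decidable)
open import Relation.Binary.PropositionalEquality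

module _ {X : Set} {f : X → X} where

  iter-+ : ∀ k l x → iter f (k + l) x ≡ iter f k (iter f l x)
  iter-+ zero    l x = refl
  iter-+ (suc k) l x = cong f (iter-+ k l x)

  iter-injective : (∀ x y → f x ≡ f y → x ≡ y) →
                   ∀ k {x y} → iter f k x ≡ iter f k y → x ≡ y
  iter-injective f-inj zero    eq = eq
  iter-injective f-inj (suc k) eq = iter-injective f-inj k (f-inj _ _ eq)

  iter-exponent-injective : (∀ x y → f x ≡ f y → x ≡ y) → (∀ k x → iter f (suc k) x ≢ x) →
                            ∀ k l x → iter f k x ≡ iter f l x → k ≡ l
  iter-exponent-injective f-inj acyclic zero    zero    x eq = refl
  iter-exponent-injective f-inj acyclic zero    (suc l) x eq = contradiction (sym eq) (acyclic l x)
  iter-exponent-injective f-inj acyclic (suc k) zero    x eq = contradiction eq (acyclic k x)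
  iter-exponent-injective f-inj acyclic (suc k) (suc l) x eq =
    cong suc (iter-exponent-injective f-inj acyclic k l x (f-inj _ _ eq))

module _ {a ℓ p : Level} {X : Set a} {_≼_ : Rel X ℓ} (≼-refl : Reflexive _≼_) (≼-trans : Transitive _≼_)
         {P : Pred X p} (P? : Decidable P) (comparable : ∀ {i j} → P i → P j → i ≼ j ⊎ j ≼ i) where

  upperBound : (l : List X) → ∀ {r} → P r → Σ X (λ u → P u × All (λ i → P i → i ≼ u) l)
  upperBound []      {r} pr = r , pr , []
  upperBound (i ∷ l)     pr with upperBound l pr
  ... | u , pu , below with P? i
  ...   | no ¬pi = u , pu , (λ pi → contradiction pi ¬pi) ∷ below
  ...   | yes pi with comparable pi pu
  ...     | inj₁ i≼u = u , pu , (λ _ → i≼u) ∷ below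
  ...     | inj₂ u≼i = i , pi , (λ _ → ≼-refl) ∷ All.map (λ j≼u pj → ≼-trans (j≼u pj) u≼i) below

module _ {N : ℕ} (𝓜 : Model N) where
  open Model 𝓜

  evalT-iter : ∀ {k} (ρ : Vector M k) m t → evalT 𝓜 ρ (iter app m t) ≡ iter f m (evalT 𝓜 ρ t)
  evalT-iter ρ zero    t = refl
  evalT-iter ρ (suc m) t = cong f (evalT-iter ρ m t)

  atomFormula : ∀ {n} → Atom 𝓜 n → Formula 𝓜 n
  atomFormula (eqf i k j) = var i ≐ iter app k (var j)
  atomFormula (eqc i a)   = var i ≐ par a

  Sat-atomFormula : ∀ {n} (x : Vector M n) at → Sat 𝓜 (atomFormula at) x ≡ HoldsAtom 𝓜 x at
  Sat-atomFormula x (eqf i k j) = cong (x i ≡_) (evalT-iter x k (var j))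
  Sat-atomFormula x (eqc i a)   = refl

  conjunction : ∀ {n} → List (Atom 𝓜 n) → Formula 𝓜 n
  conjunction []       = ¬f ⊥f
  conjunction (at ∷ L) = atomFormula at ∧f conjunction L

  Sat-conjunction⁺ : ∀ {n} {x : Vector M n} L → All (HoldsAtom 𝓜 x) L → Sat 𝓜 (conjunction L) x
  Sat-conjunction⁺         []       []       = λ ()
  Sat-conjunction⁺ {x = x} (at ∷ L) (h ∷ hs) =
    subst id (sym (Sat-atomFormula x at)) h , Sat-conjunction⁺ L hs

  Sat-conjunction⁻ : ∀ {n} {x : Vector M n} L → Sat 𝓜 (conjunction L) x → All (HoldsAtom 𝓜 x) L
  Sat-conjunction⁻         []       _        = []
  Sat-conjunction⁻ {x = x} (at ∷ L) (s , ss) =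
    subst id (Sat-atomFormula x at) s ∷ Sat-conjunction⁻ L ss

  Simple⇒Definable : ∀ {n} {A : Subset 𝓜 n} → Simple 𝓜 A → Definable 𝓜 A
  Simple⇒Definable (L , A⇒L , L⇒A) =
    conjunction L , (λ x ax → Sat-conjunction⁺ L (A⇒L x ax)) , (λ x s → L⇒A x (Sat-conjunction⁻ L s))

  Simple-∈ : ∀ {n} {A : Subset 𝓜 n} → Simple 𝓜 A → ∀ z →
             (∀ at → (∀ x → A x → HoldsAtom 𝓜 x at) → HoldsAtom 𝓜 z at) → A z
  Simple-∈ (L , A⇒L , L⇒A) z holds =
    L⇒A z (All.tabulate (λ {at} at∈L → holds at (λ x ax → All.lookup (A⇒L x ax) at∈L)))

  renameAtom : ∀ {n m} → (Fin n → Fin m) → Atom 𝓜 n → Atom 𝓜 m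
  renameAtom ρ (eqf i k j) = eqf (ρ i) k (ρ j)
  renameAtom ρ (eqc i a)   = eqc (ρ i) a

  HoldsAtom-rename : ∀ {n m} (z : Vector M m) (ρ : Fin n → Fin m) at →
                     HoldsAtom 𝓜 z (renameAtom ρ at) ≡ HoldsAtom 𝓜 (z ∘ ρ) at
  HoldsAtom-rename z ρ (eqf i k j) = refl
  HoldsAtom-rename z ρ (eqc i a)   = refl

  HoldsAtom-resp-≈ : ∀ {n} {x x′ : Vector M n} → _≈_ 𝓜 x x′ →
                     ∀ at → HoldsAtom 𝓜 x at → HoldsAtom 𝓜 x′ at
  HoldsAtom-resp-≈ x≈x′ (eqf i k j) h = trans (sym (x≈x′ i)) (trans h (cong (iter f k) (x≈x′ j)))
  HoldsAtom-resp-≈ x≈x′ (eqc i a)   h = trans (sym (x≈x′ i)) h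

  module Projection {n d : ℕ} (L : List (Atom 𝓜 n)) (r : Fin d → Fin n) where

    graphAtoms : List (Atom 𝓜 (n + d))
    graphAtoms = map (renameAtom (_↑ˡ d)) L ++ᴸ tabulate (λ a → eqf (n ↑ʳ a) 0 (r a ↑ˡ d))

    Graph : Subset 𝓜 (n + d)
    Graph z = All (HoldsAtom 𝓜 z) graphAtoms

    Graph⁺ : ∀ {x : Vector M n} {y} → All (HoldsAtom 𝓜 x) L → _≈_ 𝓜 y (x ∘ r) → Graph (x ++ y)
    Graph⁺ {x} {y} hs y≈xr = ++⁺ (map⁺ (All.map weaken hs)) (tabulate⁺ projection)
      where
      weaken : ∀ {at} → HoldsAtom 𝓜 x at → HoldsAtom 𝓜 (x ++ y) (renameAtom (_↑ˡ d) at)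
      weaken {at} h = subst id (sym (HoldsAtom-rename (x ++ y) (_↑ˡ d) at))
                        (HoldsAtom-resp-≈ (sym ∘ lookup-++ˡ x y) at h)
      projection : ∀ a → (x ++ y) (n ↑ʳ a) ≡ (x ++ y) (r a ↑ˡ d)
      projection a = trans (lookup-++ʳ x y a) (trans (y≈xr a) (sym (lookup-++ˡ x y (r a))))

    Graph⁻ : ∀ {x : Vector M n} {y} → Graph (x ++ y) → All (HoldsAtom 𝓜 x) L × _≈_ 𝓜 y (x ∘ r)
    Graph⁻ {x} {y} g with ++⁻ (map (renameAtom (_↑ˡ d)) L) g
    ... | weakened , projections = All.map strengthen (map⁻ weakened) , projection
      where
      strengthen : ∀ {at} → HoldsAtom 𝓜 (x ++ y) (renameAtom (_↑ˡ d) at) → HoldsAtom 𝓜 x at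
      strengthen {at} h = HoldsAtom-resp-≈ (lookup-++ˡ x y) at
                            (subst id (HoldsAtom-rename (x ++ y) (_↑ˡ d) at) h)
      projection : _≈_ 𝓜 y (x ∘ r)
      projection a = trans (sym (lookup-++ʳ x y a))
                       (trans (tabulate⁻ projections a) (lookup-++ˡ x y (r a)))

  projection-DefBij : ∀ {n d} {A : Subset 𝓜 n} → Simple 𝓜 A → (r : Fin d → Fin n) →
    (∀ {x x′} → A x → A x′ → _≈_ 𝓜 (x ∘ r) (x′ ∘ r) → _≈_ 𝓜 x x′) →
    (∀ y → Σ (Vector M n) (λ x → A x × _≈_ 𝓜 y (x ∘ r))) →
    DefBij 𝓜 A (Full 𝓜 d)
  projection-DefBij {A = A} (L , A⇒L , L⇒A) r injective section = record
    { G       = Graph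
    ; G-def   = Simple⇒Definable (graphAtoms , (λ _ g → g) , (λ _ g → g))
    ; G-dom   = dom
    ; G-cod   = λ _ _ _ → tt
    ; G-total = λ x ax → x ∘ r , Graph⁺ (A⇒L x ax) (λ _ → refl)
    ; G-func  = λ x y y′ g g′ a → trans (proj₂ (Graph⁻ g) a) (sym (proj₂ (Graph⁻ g′) a))
    ; G-surj  = λ y _ → let (x , ax , y≈xr) = section y in x , Graph⁺ (A⇒L x ax) y≈xr
    ; G-inj   = λ x x′ y g g′ → injective (dom x y g) (dom x′ y g′)
                  (λ a → trans (sym (proj₂ (Graph⁻ g) a)) (proj₂ (Graph⁻ g′) a))
    }
    where
    open Projection L r
    dom : ∀ x y → Graph (x ++ y) → A x
    dom x y g = L⇒A x (proj₁ (Graph⁻ g))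

  record IterEq {n : ℕ} (A : Subset 𝓜 n) (i : Fin n) (k : ℕ) (j : Fin n) : Set where
    constructor iterEq
    field holds : ∀ x → A x → x i ≡ iter f k (x j)
  open IterEq

  IterateOf : ∀ {n} → Subset 𝓜 n → Rel (Fin n) _
  IterateOf A i j = Σ ℕ (λ k → IterEq A i k j)

  module _ {n : ℕ} {A : Subset 𝓜 n} where

    IterEq-refl : ∀ {i} → IterEq A i 0 i
    IterEq-refl = iterEq λ _ _ → refl

    IterEq-trans : ∀ {i j m k l} → IterEq A i k j → IterEq A j l m → IterEq A i (k + l) m
    IterEq-trans {m = m} {k} {l} (iterEq hij) (iterEq hjm) = iterEq λ x ax →
      trans (hij x ax) (trans (cong (iter f k) (hjm x ax)) (sym (iter-+ k l (x m))))

    IterateOf-refl : Reflexive (IterateOf A)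
    IterateOf-refl = 0 , IterEq-refl

    IterateOf-trans : Transitive (IterateOf A)
    IterateOf-trans (k , hij) (l , hjm) = k + l , IterEq-trans hij hjm

    Linked⇒comparable : ∀ {i j} → Linked 𝓜 A i j → IterateOf A i j ⊎ IterateOf A j i
    Linked⇒comparable (k , inj₁ h) = inj₁ (k , iterEq h)
    Linked⇒comparable (k , inj₂ h) = inj₂ (k , iterEq h)

    IsConst-iterate : ∀ {i k j} → IterEq A i k j → IsConst 𝓜 A j → IsConst 𝓜 A i
    IsConst-iterate {k = k} (iterEq h) (v , hv) =
      iter f k v , λ x ax → trans (h x ax) (cong (iter f k) (hv x ax))

    module _ {x₀} (x₀∈A : A x₀) where

      IsConst-iterate⁻ : ∀ {i k j} → IterEq A i k j → IsConst 𝓜 A i → IsConst 𝓜 A j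
      IsConst-iterate⁻ {k = k} {j} (iterEq h) (v , hv) = x₀ j , λ x ax → iter-injective f-inj k
        (trans (sym (h x ax)) (trans (hv x ax) (trans (sym (hv x₀ x₀∈A)) (h x₀ x₀∈A))))

      IterEq-exponent-unique : ∀ {i k l j} → IterEq A i k j → IterEq A i l j → k ≡ l
      IterEq-exponent-unique {k = k} {l} {j} (iterEq hk) (iterEq hl) =
        iter-exponent-injective f-inj acyclic k l (x₀ j) (trans (sym (hk x₀ x₀∈A)) (hl x₀ x₀∈A))

  module Classes {n d : ℕ} {A : Subset 𝓜 n} {x₀} (x₀∈A : A x₀) (H : HasClasses 𝓜 A d) where
    open HasClasses H

    member⇒¬IsConst : ∀ {i a} → cls i ≡ just a → ¬ IsConst 𝓜 A i
    member⇒¬IsConst {i} e c with () ← trans (sym e) (C-cls i c)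

    classMaximum : ∀ a → Σ (Fin n) (λ r →
                     cls r ≡ just a × All (λ i → cls i ≡ just a → IterateOf A i r) (allFin n))
    classMaximum a = upperBound IterateOf-refl IterateOf-trans (λ i → ≡-decᵐ _≟ᶠ_ (cls i) (just a))
      (λ ei ej → Linked⇒comparable (cls-sound _ _ a a ei ej refl)) (allFin n) (proj₂ (cls-surj a))

    root : Fin d → Fin n
    root a = proj₁ (classMaximum a)

    root-cls : ∀ a → cls (root a) ≡ just a
    root-cls a = proj₁ (proj₂ (classMaximum a))

    below-root : ∀ {i a} → cls i ≡ just a → IterateOf A i (root a)
    below-root {i} {a} = tabulate⁻ (proj₂ (proj₂ (classMaximum a))) i

    data Kind (i : Fin n) : Set where
      constant : IsConst 𝓜 A i → Kind i
      member   : ∀ a → cls i ≡ just a → Kind i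

    kind : ∀ i → Kind i
    kind i with cls i in e
    ... | nothing = constant (cls-C i e)
    ... | just a  = member a e

    sectionAt : Vector M d → ∀ i → Kind i → M
    sectionAt y i (constant (v , _)) = v
    sectionAt y i (member a e)       = iter f (proj₁ (below-root e)) (y a)

    section : Vector M d → Vector M n
    section y i = sectionAt y i (kind i)

    sectionAt-IterEq : ∀ y {i k j} → IterEq A i k j →
                       ∀ κi κj → sectionAt y i κi ≡ iter f k (sectionAt y j κj)
    sectionAt-IterEq y {k = k} (iterEq h) (constant (v , hv)) (constant (w , hw)) =
      trans (sym (hv x₀ x₀∈A)) (trans (h x₀ x₀∈A) (cong (iter f k) (hw x₀ x₀∈A)))
    sectionAt-IterEq y h (constant c) (member b e) =
      contradiction (IsConst-iterate⁻ x₀∈A h c) (member⇒¬IsConst e)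
    sectionAt-IterEq y h (member b e) (constant c) =
      contradiction (IsConst-iterate h c) (member⇒¬IsConst e)
    sectionAt-IterEq y {i} {k} {j} h (member b ei) (member b′ ej)
      with refl ← cls-compl i j b b′ ei ej (k , inj₁ (holds h)) = begin
        iter f ki (y b)             ≡⟨ cong (λ m → iter f m (y b)) ki≡k+kj ⟩
        iter f (k + kj) (y b)       ≡⟨ iter-+ k kj (y b) ⟩
        iter f k (iter f kj (y b))  ∎
      where
      open ≡-Reasoning
      ki = proj₁ (below-root ei)
      kj = proj₁ (below-root ej)
      ki≡k+kj : ki ≡ k + kj
      ki≡k+kj = IterEq-exponent-unique x₀∈A (proj₂ (below-root ei))
                  (IterEq-trans h (proj₂ (below-root ej)))

    sectionAt-constant : ∀ y {i v} → (∀ x → A x → x i ≡ v) → ∀ κ → sectionAt y i κ ≡ v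
    sectionAt-constant y h (constant (w , hw)) = trans (sym (hw x₀ x₀∈A)) (h x₀ x₀∈A)
    sectionAt-constant y h (member b e)        = contradiction (_ , h) (member⇒¬IsConst e)

    section-∈ : Simple 𝓜 A → ∀ y → A (section y)
    section-∈ simple y = Simple-∈ simple (section y) satisfies
      where
      satisfies : ∀ at → (∀ x → A x → HoldsAtom 𝓜 x at) → HoldsAtom 𝓜 (section y) at
      satisfies (eqf i k j) h = sectionAt-IterEq y {k = k} (iterEq h) (kind i) (kind j)
      satisfies (eqc i v)   h = sectionAt-constant y h (kind i)

    sectionAt-root : ∀ y a κ → sectionAt y (root a) κ ≡ y a
    sectionAt-root y a (constant c) = contradiction c (member⇒¬IsConst (root-cls a))
    sectionAt-root y a (member b e) with refl ← just-injective (trans (sym e) (root-cls a)) =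
      cong (λ m → iter f m (y a)) (IterEq-exponent-unique x₀∈A (proj₂ (below-root e)) IterEq-refl)

    section-root : ∀ y → _≈_ 𝓜 y (section y ∘ root)
    section-root y a = sym (sectionAt-root y a (kind (root a)))

    projection-injective : ∀ {x x′} → A x → A x′ → _≈_ 𝓜 (x ∘ root) (x′ ∘ root) → _≈_ 𝓜 x x′
    projection-injective ax ax′ eq i with kind i
    ... | constant (v , hv) = trans (hv _ ax) (sym (hv _ ax′))
    ... | member a e with below-root e
    ...   | k , iterEq h = trans (h _ ax) (trans (cong (iter f k) (eq a)) (sym (h _ ax′)))

lemma4p5 : {N : ℕ} → 1 ≤ N → (𝓜 : Model N) → (n : ℕ) → (A : Subset 𝓜 n) →
    Simple 𝓜 A → Σ (Vector (Model.M 𝓜) n) A →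
    (d : ℕ) → HasClasses 𝓜 A d → DefBij 𝓜 A (Full 𝓜 d)
lemma4p5 _ 𝓜 n A simple (x₀ , x₀∈A) d classes =
  projection-DefBij 𝓜 simple root projection-injective
    (λ y → section y , section-∈ simple y , section-root y)
  where open Classes 𝓜 x₀∈A classes
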